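{- Let $y=y_0+y_1p+y_2p^2+\cdots\in\mathbb{Z}_p\setminus\mathbb{N}$ (with $0\le y_i\le p-1$, so infinitely many $y_i$ are nonzero) and for $t\ge0$ let $\tilde y(t):=\sum_{i=0}^t y_ip^i$. Then for every fixed $m\ge1$ there exists a positive integer $t'$ such that $U_m(\tilde y(t))$ is nonempty for all $t\ge t'$.
   Context: Let $p$ be a prime, $s\ge1$. For a positive integer $N$ and $m\ge1$, $U_m(N)$ is the set of $m$-tuples $(X_1,\dots,X_m)$ of nonnegative integers with $X_1+\dots+X_m=N$ such that (i) there is no carryover of $p$-adic digits in the sum $N=\sum X_j$ (for each $j\ge0$ the $j$-th base-$p$ digits of the $X_i$ sum to the $j$-th base-$p$ digit of $N$), and (ii) $X_j>0$ and $(p^s-1)\mid X_j$ for $1\le j\le m-1$. -}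

module Defs where

open import Data.Nat using (ℕ; zero; suc; _+_; _*_; _∸_; _^_; _<_; NonZero)
open import Data.Nat.DivMod using (_/_; _%_)
open import Data.Nat.Divisibility using (_∣_)
open import Data.Nat.Properties using (m^n≢0)
open import Data.Fin using (Fin; toℕ) renaming (zero to fzero; suc to fsuc)
open import Data.Product using (_×_)
open import Relation.Binary.PropositionalEquality using (_≡_)

sumF : ∀ {m} → (Fin m → ℕ) → ℕ
sumF {zero}  X = 0
sumF {suc m} X = X fzero + sumF (λ i → X (fsuc i))

digit : (p : ℕ) → .{{NonZero p}} → ℕ → ℕ → ℕ
digit p j n = ((n / (p ^ j)) {{m^n≢0 p j}}) % p

ytilde : (p : ℕ) → (ℕ → ℕ) → ℕ → ℕ
ytilde p y zero    = y 0
ytilde p y (suc t) = ytilde p y t + y (suc t) * p ^ suc t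

-- X ∈ U_m(N), with X indexed 0..m-1 (paper's X_1..X_m are X 0 .. X (m-1))
InU : (p : ℕ) → .{{NonZero p}} → (s m N : ℕ) → (Fin m → ℕ) → Set
InU p s m N X =
  (sumF X ≡ N) ×
  ((j : ℕ) → sumF (λ i → digit p j (X i)) ≡ digit p j N) ×
  ((i : Fin m) → suc (toℕ i) < m → (0 < X i) × ((p ^ s ∸ 1) ∣ X i))

{-# OPTIONS --safe #-}
module Submission where

-- Pigeonhole over the partial sums ỹ(t) at the infinitely many positions with y_t ≠ 0 gives a < b
-- with y_b ≠ 0 and ỹ(a) ≡ ỹ(b) mod p^s − 1.  The digits of y in (a, b] then form ỹ(b) − ỹ(a), a
-- positive multiple of p^s − 1 whose digits are disjoint from the remaining digits of y, and those
-- still include infinitely many nonzero ones.  Splitting off m − 1 such blocks, the remaining digits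
-- up to t form the last summand, and adding digit-disjoint numbers produces no carries.

open import Defs
open import Data.Bool using (true; false; if_then_else_)
open import Data.Fin using (Fin; toℕ) renaming (zero to fzero; suc to fsuc)
open import Data.Fin.Properties using (pigeonhole; toℕ-fromℕ<)
open import Data.Nat using (ℕ; zero; suc; _+_; _*_; _∸_; _^_; _≤_; _<_; _⊔_; _≤′_; ≤′-refl; ≤′-step; NonZero; z≤n; s≤s; s≤s⁻¹; _<?_; _≤?_; >-nonZero; >-nonZero⁻¹; ≢-nonZero; nonTrivial⇒n>1)
open import Data.Nat.Properties
open import Data.Nat.DivMod
open import Data.Nat.Divisibility using (_∣_; ∣m+n∣m⇒∣n; n∣m*n)
open import Data.Nat.Primality using (Prime; prime⇒nonTrivial)
open import Data.Nat.Solver using (module +-*-Solver)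
open import Data.Sum using (inj₁; inj₂)
open import Data.Product using (∃; ∃₂; _×_; _,_; proj₁; proj₂)
open import Data.Vec.Functional using (_∷_)
open import Level using (0ℓ)
open import Function using (_∘_)
open import Relation.Binary.PropositionalEquality using (_≡_; _≢_; refl; sym; trans; cong; cong₂; subst; module ≡-Reasoning)
open import Relation.Nullary using (¬_; does; yes; no)
open import Relation.Nullary.Decidable using (dec-true; dec-false; ¬?; _×-dec_)
open import Relation.Unary using (Pred; Decidable)

open +-*-Solver using (solve; _:+_; _:*_; _:=_; con)
open ≡-Reasoning

≡-mod⇒∣-gap : ∀ {a k b} d .{{_ : NonZero d}} → a + k ≡ b → a % d ≡ b % d → d ∣ k
≡-mod⇒∣-gap {a} {k} {b} d a+k≡b a≡b = ∣m+n∣m⇒∣n (subst (d ∣_) (sym gap) (n∣m*n (b / d))) (n∣m*n (a / d))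
  where
  gap : a / d * d + k ≡ b / d * d
  gap = +-cancelˡ-≡ (a % d) _ _ (begin
    a % d + (a / d * d + k)  ≡⟨ +-assoc (a % d) _ k ⟨
    a % d + a / d * d + k    ≡⟨ cong (_+ k) (m≡m%n+[m/n]*n a d) ⟨
    a + k                    ≡⟨ a+k≡b ⟩
    b                        ≡⟨ m≡m%n+[m/n]*n b d ⟩
    b % d + b / d * d        ≡⟨ cong (_+ b / d * d) a≡b ⟨
    a % d + b / d * d        ∎)

Unbounded : Pred ℕ 0ℓ → Set
Unbounded P = ∀ n → ∃ λ i → n ≤ i × P i

module _ {P : Pred ℕ 0ℓ} (unbounded : Unbounded P) where

  enumerate : ℕ → ℕ
  enumerate zero    = proj₁ (unbounded 0)
  enumerate (suc k) = proj₁ (unbounded (suc (enumerate k)))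

  enumerate-∈ : ∀ k → P (enumerate k)
  enumerate-∈ zero    = proj₂ (proj₂ (unbounded 0))
  enumerate-∈ (suc k) = proj₂ (proj₂ (unbounded (suc (enumerate k))))

  enumerate-< : ∀ k → enumerate k < enumerate (suc k)
  enumerate-< k = proj₁ (proj₂ (unbounded (suc (enumerate k))))

  enumerate-mono-≤′ : ∀ {k l} → k ≤′ l → enumerate k ≤ enumerate l
  enumerate-mono-≤′ ≤′-refl        = ≤-refl
  enumerate-mono-≤′ {l = suc l} (≤′-step k≤′l) = ≤-trans (enumerate-mono-≤′ k≤′l) (<⇒≤ (enumerate-< l))

  enumerate-strictMono : ∀ {k l} → k < l → enumerate k < enumerate l
  enumerate-strictMono {k} k<l = <-≤-trans (enumerate-< k) (enumerate-mono-≤′ (≤⇒≤′ k<l))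

unbounded-pigeonhole-% : ∀ {P : Pred ℕ 0ℓ} → Unbounded P → (f : ℕ → ℕ) (d : ℕ) .{{_ : NonZero d}} →
  ∃₂ λ a b → a < b × P b × f a % d ≡ f b % d
unbounded-pigeonhole-% unbounded f d
  with i , j , i<j , fi≡fj ← pigeonhole (n<1+n d) (λ k → f (enumerate unbounded (toℕ k)) mod d)
  = _ , _ , enumerate-strictMono unbounded i<j , enumerate-∈ unbounded (toℕ j) ,
    trans (sym (toℕ-fromℕ< _)) (trans (cong toℕ fi≡fj) (toℕ-fromℕ< _))

mask : {P : Pred ℕ 0ℓ} → Decidable P → (ℕ → ℕ) → ℕ → ℕ
mask P? c i = if does (P? i) then c i else 0

mask-∈ : ∀ {P : Pred ℕ 0ℓ} (P? : Decidable P) c {i} → P i → mask P? c i ≡ c i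
mask-∈ P? c {i} Pi rewrite dec-true (P? i) Pi = refl

mask-∉ : ∀ {P : Pred ℕ 0ℓ} (P? : Decidable P) c {i} → ¬ P i → mask P? c i ≡ 0
mask-∉ P? c {i} ¬Pi rewrite dec-false (P? i) ¬Pi = refl

mask-+-mask-¬ : ∀ {P : Pred ℕ 0ℓ} (P? : Decidable P) c i → mask P? c i + mask (¬? ∘ P?) c i ≡ c i
mask-+-mask-¬ P? c i with does (P? i)
... | true  = +-identityʳ (c i)
... | false = refl

module _ (p : ℕ) where

  ytilde-+ : ∀ {c₁ c₂ c} → (∀ i → c₁ i + c₂ i ≡ c i) → ∀ t → ytilde p c₁ t + ytilde p c₂ t ≡ ytilde p c t
  ytilde-+ c₁+c₂≗c zero    = c₁+c₂≗c 0
  ytilde-+ {c₁} {c₂} {c} c₁+c₂≗c (suc t) = begin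
    ytilde p c₁ t + c₁ (suc t) * q + (ytilde p c₂ t + c₂ (suc t) * q)
      ≡⟨ solve 5 (λ A a B b Q → A :+ a :* Q :+ (B :+ b :* Q) := A :+ B :+ (a :+ b) :* Q) refl
           (ytilde p c₁ t) (c₁ (suc t)) (ytilde p c₂ t) (c₂ (suc t)) q ⟩
    ytilde p c₁ t + ytilde p c₂ t + (c₁ (suc t) + c₂ (suc t)) * q
      ≡⟨ cong₂ (λ u v → u + v * q) (ytilde-+ c₁+c₂≗c t) (c₁+c₂≗c (suc t)) ⟩
    ytilde p c t + c (suc t) * q ∎
    where q = p ^ suc t

  ytilde-cong : ∀ {c d} t → (∀ i → i ≤ t → c i ≡ d i) → ytilde p c t ≡ ytilde p d t
  ytilde-cong zero    c≗d = c≗d 0 z≤n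
  ytilde-cong (suc t) c≗d =
    cong₂ (λ u v → u + v * p ^ suc t) (ytilde-cong t (λ i i≤t → c≗d i (m≤n⇒m≤1+n i≤t))) (c≗d (suc t) ≤-refl)

  ytilde-stable : ∀ {c a} t → a ≤ t → (∀ i → a < i → i ≤ t → c i ≡ 0) → ytilde p c t ≡ ytilde p c a
  ytilde-stable zero    z≤n  _ = refl
  ytilde-stable {c} {a} (suc t) a≤1+t vanish with m≤n⇒m<n∨m≡n a≤1+t
  ... | inj₂ refl = refl
  ... | inj₁ a<1+t = begin
    ytilde p c t + c (suc t) * p ^ suc t
      ≡⟨ cong (λ d → ytilde p c t + d * p ^ suc t) (vanish (suc t) a<1+t ≤-refl) ⟩
    ytilde p c t + 0
      ≡⟨ +-identityʳ _ ⟩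
    ytilde p c t
      ≡⟨ ytilde-stable t (s≤s⁻¹ a<1+t) (λ i a<i i≤t → vanish i a<i (m≤n⇒m≤1+n i≤t)) ⟩
    ytilde p c a ∎

  ytilde-horner : ∀ c t → ytilde p c (suc t) ≡ c 0 + ytilde p (c ∘ suc) t * p
  ytilde-horner c zero    = solve 3 (λ a b q → a :+ b :* (q :* con 1) := a :+ b :* q) refl (c 0) (c 1) p
  ytilde-horner c (suc t) = begin
    ytilde p c (suc t) + c (2 + t) * (p * q)
      ≡⟨ cong (_+ c (2 + t) * (p * q)) (ytilde-horner c t) ⟩
    c 0 + ytilde p (c ∘ suc) t * p + c (2 + t) * (p * q)
      ≡⟨ solve 5 (λ a Y C Q P → a :+ Y :* P :+ C :* (P :* Q) := a :+ (Y :+ C :* Q) :* P) refl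
           (c 0) (ytilde p (c ∘ suc) t) (c (2 + t)) q p ⟩
    c 0 + (ytilde p (c ∘ suc) t + c (2 + t) * q) * p ∎
    where q = p ^ suc t

module _ (p : ℕ) .{{_ : NonZero p}} where

  Digits : (ℕ → ℕ) → Set
  Digits c = ∀ i → c i < p

  ytilde-pos : ∀ {c} t → c t ≢ 0 → 0 < ytilde p c t
  ytilde-pos zero    c₀≢0 = n≢0⇒n>0 c₀≢0
  ytilde-pos {c} (suc t) cₜ≢0 = <-≤-trans (>-nonZero⁻¹ _ {{m*n≢0 _ _ {{≢-nonZero cₜ≢0}} {{m^n≢0 p (suc t)}}}}) (m≤n+m _ _)

  digit-0 : ∀ n → digit p 0 n ≡ n % p
  digit-0 n = cong (_% p) (n/1≡n n)

  digit-suc : ∀ j n → digit p (suc j) n ≡ digit p j (n / p)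
  digit-suc j n = cong (_% p) (sym (m/n/o≡m/[n*o] n p (p ^ j) {{_}} {{m^n≢0 p j}} {{m^n≢0 p (suc j)}}))

  digit-of-0 : ∀ j → digit p j 0 ≡ 0
  digit-of-0 j = trans (cong (_% p) (0/n≡0 (p ^ j) {{m^n≢0 p j}})) (m<n⇒m%n≡m (>-nonZero⁻¹ p))

  digit-0-horner : ∀ {a} R → a < p → digit p 0 (a + R * p) ≡ a
  digit-0-horner {a} R a<p = trans (digit-0 _) (trans ([m+kn]%n≡m%n a R p) (m<n⇒m%n≡m a<p))

  digit-suc-horner : ∀ {a} j R → a < p → digit p (suc j) (a + R * p) ≡ digit p j R
  digit-suc-horner {a} j R a<p = trans (digit-suc j _) (cong (digit p j) (begin
    (a + R * p) / p    ≡⟨ +-distrib-/-∣ʳ a (n∣m*n R) ⟩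
    a / p + R * p / p  ≡⟨ cong₂ _+_ (m<n⇒m/n≡0 a<p) (m*n/n≡m R p) ⟩
    R                  ∎))

  digit-ytilde-≤ : ∀ {c j t} → Digits c → j ≤ t → digit p j (ytilde p c t) ≡ c j
  digit-ytilde-≤ {c} {zero} {zero} cs _ = trans (digit-0 (c 0)) (m<n⇒m%n≡m (cs 0))
  digit-ytilde-≤ {c} {zero} {suc t} cs _ =
    trans (cong (digit p 0) (ytilde-horner p c t)) (digit-0-horner (ytilde p (c ∘ suc) t) (cs 0))
  digit-ytilde-≤ {c} {suc j} {suc t} cs (s≤s j≤t) = begin
    digit p (suc j) (ytilde p c (suc t))                   ≡⟨ cong (digit p (suc j)) (ytilde-horner p c t) ⟩
    digit p (suc j) (c 0 + ytilde p (c ∘ suc) t * p)        ≡⟨ digit-suc-horner j _ (cs 0) ⟩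
    digit p j (ytilde p (c ∘ suc) t)                        ≡⟨ digit-ytilde-≤ (cs ∘ suc) j≤t ⟩
    c (suc j)                                               ∎

  digit-ytilde-> : ∀ {c j t} → Digits c → t < j → digit p j (ytilde p c t) ≡ 0
  digit-ytilde-> {c} {suc j} {zero} cs _ = begin
    digit p (suc j) (c 0)   ≡⟨ digit-suc j (c 0) ⟩
    digit p j (c 0 / p)     ≡⟨ cong (digit p j) (m<n⇒m/n≡0 (cs 0)) ⟩
    digit p j 0             ≡⟨ digit-of-0 j ⟩
    0                       ∎
  digit-ytilde-> {c} {suc j} {suc t} cs (s≤s t<j) = begin
    digit p (suc j) (ytilde p c (suc t))                   ≡⟨ cong (digit p (suc j)) (ytilde-horner p c t) ⟩
    digit p (suc j) (c 0 + ytilde p (c ∘ suc) t * p)        ≡⟨ digit-suc-horner j _ (cs 0) ⟩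
    digit p j (ytilde p (c ∘ suc) t)                        ≡⟨ digit-ytilde-> (cs ∘ suc) t<j ⟩
    0                                                       ∎

  digit-ytilde-+ : ∀ {c₁ c₂ c} → Digits c₁ → Digits c₂ → Digits c → (∀ i → c₁ i + c₂ i ≡ c i) →
    ∀ t j → digit p j (ytilde p c₁ t) + digit p j (ytilde p c₂ t) ≡ digit p j (ytilde p c t)
  digit-ytilde-+ cs₁ cs₂ cs c₁+c₂≗c t j with j ≤? t
  ... | yes j≤t rewrite digit-ytilde-≤ cs₁ j≤t | digit-ytilde-≤ cs₂ j≤t | digit-ytilde-≤ cs j≤t = c₁+c₂≗c j
  ... | no  j≰t rewrite digit-ytilde-> cs₁ (≰⇒> j≰t) | digit-ytilde-> cs₂ (≰⇒> j≰t) | digit-ytilde-> cs (≰⇒> j≰t) = refl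

  InBlock : ℕ → ℕ → Pred ℕ 0ℓ
  InBlock a b i = a < i × i ≤ b

  inBlock? : ∀ a b → Decidable (InBlock a b)
  inBlock? a b i = a <? i ×-dec i ≤? b

  record BlockSplit (q : ℕ) (y : ℕ → ℕ) : Set where
    field
      end          : ℕ
      block rest   : ℕ → ℕ
      block+rest   : ∀ i → block i + rest i ≡ y i
      block-beyond : ∀ i → end < i → block i ≡ 0
      block-pos    : 0 < ytilde p block end
      block-div    : q ∣ ytilde p block end

    block-stable : ∀ {t} → end ≤ t → ytilde p block t ≡ ytilde p block end
    block-stable {t} end≤t = ytilde-stable p t end≤t (λ i end<i _ → block-beyond i end<i)

    block-digits : Digits y → Digits block
    block-digits ys i = ≤-<-trans (subst (block i ≤_) (block+rest i) (m≤m+n _ _)) (ys i)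

    rest-digits : Digits y → Digits rest
    rest-digits ys i = ≤-<-trans (subst (rest i ≤_) (block+rest i) (m≤n+m _ _)) (ys i)

    rest-unbounded : Unbounded (λ i → y i ≢ 0) → Unbounded (λ i → rest i ≢ 0)
    rest-unbounded unbounded n with i , 1+n⊔end≤i , yᵢ≢0 ← unbounded (suc (n ⊔ end)) =
      i , ≤-trans (m≤m⊔n n end) (<⇒≤ 1+n⊔end≤i) , λ restᵢ≡0 → yᵢ≢0 (begin
        y i               ≡⟨ block+rest i ⟨
        block i + rest i  ≡⟨ cong₂ _+_ (block-beyond i (≤-<-trans (m≤n⊔m n end) 1+n⊔end≤i)) restᵢ≡0 ⟩
        0                 ∎)

  block-split : ∀ q .{{_ : NonZero q}} {y} → Unbounded (λ i → y i ≢ 0) → BlockSplit q y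
  block-split q {y} unbounded
    with a , b , a<b , y_b≢0 , ỹa≡ỹb ← unbounded-pigeonhole-% unbounded (ytilde p y) q = record
    { end          = b
    ; block        = block
    ; rest         = rest
    ; block+rest   = mask-+-mask-¬ (inBlock? a b) y
    ; block-beyond = λ i b<i → mask-∉ (inBlock? a b) y (λ (_ , i≤b) → <⇒≱ b<i i≤b)
    ; block-pos    = ytilde-pos b (subst (_≢ 0) (sym (mask-∈ (inBlock? a b) y (a<b , ≤-refl))) y_b≢0)
    ; block-div    = ≡-mod⇒∣-gap q ỹa+block≡ỹb ỹa≡ỹb
    }
    where
    block rest : ℕ → ℕ
    block = mask (inBlock? a b) y
    rest  = mask (¬? ∘ inBlock? a b) y

    rest≡ỹa : ytilde p rest b ≡ ytilde p y a
    rest≡ỹa = trans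
      (ytilde-stable p b (<⇒≤ a<b) (λ i a<i i≤b → mask-∉ (¬? ∘ inBlock? a b) y (λ ∉ → ∉ (a<i , i≤b))))
      (ytilde-cong p a (λ i i≤a → mask-∈ (¬? ∘ inBlock? a b) y (λ (a<i , _) → <⇒≱ a<i i≤a)))

    ỹa+block≡ỹb : ytilde p y a + ytilde p block b ≡ ytilde p y b
    ỹa+block≡ỹb = begin
      ytilde p y a + ytilde p block b     ≡⟨ +-comm (ytilde p y a) _ ⟩
      ytilde p block b + ytilde p y a     ≡⟨ cong (ytilde p block b +_) rest≡ỹa ⟨
      ytilde p block b + ytilde p rest b  ≡⟨ ytilde-+ p (mask-+-mask-¬ (inBlock? a b) y) b ⟩
      ytilde p y b                        ∎

module _ (p s : ℕ) .{{_ : NonZero p}} where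

  InU-singleton : ∀ N → InU p s 1 N (λ _ → N)
  InU-singleton N = +-identityʳ N , (λ j → +-identityʳ _) , λ { fzero (s≤s ()) }

  InU-∷ : ∀ {m Z N′ N} {X : Fin m → ℕ} → Z + N′ ≡ N → (∀ j → digit p j Z + digit p j N′ ≡ digit p j N) →
    0 < Z → (p ^ s ∸ 1) ∣ Z → InU p s m N′ X → InU p s (suc m) N (Z ∷ X)
  InU-∷ {Z = Z} sum digits Z>0 q∣Z (sum′ , digits′ , admissible) =
    trans (cong (Z +_) sum′) sum ,
    (λ j → trans (cong (digit p j Z +_) (digits′ j)) (digits j)) ,
    λ { fzero _ → Z>0 , q∣Z ; (fsuc i) 2+i<2+m → admissible i (s≤s⁻¹ 2+i<2+m) }

  EventuallyInU : ℕ → (ℕ → ℕ) → Set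
  EventuallyInU m y = ∃ λ T → 1 ≤ T × ∀ t → T ≤ t → ∃ (InU p s m (ytilde p y t))

  module _ .{{_ : NonZero (p ^ s ∸ 1)}} where

    eventuallyInU-∷ : ∀ {m y} → Digits p y → (split : BlockSplit p (p ^ s ∸ 1) y) →
      EventuallyInU m (BlockSplit.rest split) → EventuallyInU (suc m) y
    eventuallyInU-∷ {m} {y} ys split (T , 1≤T , U) =
      T ⊔ end , ≤-trans 1≤T (m≤m⊔n T end) ,
      λ t T⊔end≤t → extend (m⊔n≤o⇒n≤o T end T⊔end≤t) (U t (m⊔n≤o⇒m≤o T end T⊔end≤t))
      where
      open BlockSplit split
      extend : ∀ {t} → end ≤ t → ∃ (InU p s m (ytilde p rest t)) → ∃ (InU p s (suc m) (ytilde p y t))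
      extend {t} end≤t (X , X∈U) =
        ytilde p block t ∷ X ,
        InU-∷ (ytilde-+ p block+rest t)
              (digit-ytilde-+ p (block-digits ys) (rest-digits ys) ys block+rest t)
              (subst (0 <_) (sym (block-stable end≤t)) block-pos)
              (subst (_ ∣_) (sym (block-stable end≤t)) block-div)
              X∈U

    eventuallyInU : ∀ m {y} → Digits p y → Unbounded (λ i → y i ≢ 0) → EventuallyInU (suc m) y
    eventuallyInU zero    {y} _  _         = 1 , ≤-refl , λ t _ → _ , InU-singleton (ytilde p y t)
    eventuallyInU (suc m) {y} ys unbounded =
      eventuallyInU-∷ ys split (eventuallyInU m (rest-digits ys) (rest-unbounded unbounded))
      where
      split : BlockSplit p (p ^ s ∸ 1) y
      split = block-split p (p ^ s ∸ 1) unbounded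
      open BlockSplit split

^-∸1-nonZero : ∀ {p s} → 1 < p → 0 < s → NonZero (p ^ s ∸ 1)
^-∸1-nonZero {p} 1<p 0<s = >-nonZero (m<n⇒0<n∸m (^-monoʳ-< p 1<p 0<s))

lemma2p1 : (p : ℕ) → .{{_ : NonZero p}} → Prime p → (s : ℕ) → 1 ≤ s →
    (y : ℕ → ℕ) → (∀ i → y i < p) → (∀ n → ∃ λ i → n ≤ i × ¬ (y i ≡ 0)) →
    (m : ℕ) → 1 ≤ m →
    ∃ λ t′ → 1 ≤ t′ × (∀ t → t′ ≤ t → ∃ λ (X : Fin m → ℕ) → InU p s m (ytilde p y t) X)
lemma2p1 p p-prime s 1≤s y digits unbounded (suc m) _ =
  eventuallyInU p s {{_}} {{^-∸1-nonZero (nonTrivial⇒n>1 p {{prime⇒nonTrivial p-prime}}) 1≤s}} m digits unbounded
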